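{- Let $\Gamma$ be a graph with maximum degree three. If $\Pi$ is a subgraph of $\Gamma$, then $\Gamma$ does not admit a partial orientation as a quasi-transitive mixed graph.
   Context: $\Pi$ is the graph on six vertices $u,v,w,u',v',w'$ with edges $uv, vw, wu, uu', vv', ww'$ (a triangle with a pendant edge at each vertex). A mixed graph has a vertex set, a set of (undirected) edges and a set of arcs, with at most one edge or arc between any pair of vertices. A partial orientation of a graph is a mixed graph obtained by orienting some of its edges as arcs. A $2$-dipath is a directed path $xyz$ consisting of arcs $x\to y$, $y\to z$; it is induced if $x$ and $z$ are not joined by an edge or arc. A mixed graph $H$ is quasi-transitive when (1) it has no induced $2$-dipath and (2) for every edge $xy$ there is $t$ with $xty$ or $ytx$ a $2$-dipath. -}

module Defs where

open import Data.Nat using (ℕ; _≤_)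
open import Data.Fin using (Fin; zero; suc)
open import Data.Bool using (Bool; true; false; if_then_else_)
open import Data.List using (List; map; allFin)
open import Data.Nat.ListAction using (sum)
open import Data.Product using (Σ; _×_; ∃)
open import Data.Sum using (_⊎_)
open import Data.Empty using (⊥)
open import Function.Definitions using (Injective)
open import Relation.Binary.PropositionalEquality using (_≡_; _≢_)

record Graph (n : ℕ) : Set where
  field
    adj     : Fin n → Fin n → Bool
    adj-sym : ∀ x y → adj x y ≡ adj y x
    irrefl  : ∀ x → adj x x ≡ false
open Graph public

degree : ∀ {n} → Graph n → Fin n → ℕ
degree {n} G x = sum (map (λ y → if adj G x y then 1 else 0) (allFin n))

MaxDegreeAtMost3 : ∀ {n} → Graph n → Set
MaxDegreeAtMost3 G = ∀ x → degree G x ≤ 3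

-- The graph Π on Fin 6: u=0, v=1, w=2, u'=3, v'=4, w'=5,
-- edges uv, vw, wu, uu', vv', ww'.
Π-adj : Fin 6 → Fin 6 → Bool
Π-adj zero (suc zero) = true
Π-adj (suc zero) zero = true
Π-adj (suc zero) (suc (suc zero)) = true
Π-adj (suc (suc zero)) (suc zero) = true
Π-adj (suc (suc zero)) zero = true
Π-adj zero (suc (suc zero)) = true
Π-adj zero (suc (suc (suc zero))) = true
Π-adj (suc (suc (suc zero))) zero = true
Π-adj (suc zero) (suc (suc (suc (suc zero)))) = true
Π-adj (suc (suc (suc (suc zero)))) (suc zero) = true
Π-adj (suc (suc zero)) (suc (suc (suc (suc (suc zero))))) = true
Π-adj (suc (suc (suc (suc (suc zero))))) (suc (suc zero)) = true
Π-adj _ _ = false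

PiSubgraphOf : ∀ {n} → Graph n → Set
PiSubgraphOf {n} G =
  Σ (Fin 6 → Fin n) λ f →
    Injective _≡_ _≡_ f × (∀ a b → Π-adj a b ≡ true → adj G (f a) (f b) ≡ true)

-- Edges of G that carry no arc
-- remain (undirected) edges of the resulting mixed graph.
record PartialOrientation {n} (G : Graph n) : Set where
  field
    arc        : Fin n → Fin n → Bool
    arc-edge   : ∀ x y → arc x y ≡ true → adj G x y ≡ true
    arc-unique : ∀ x y → arc x y ≡ true → arc y x ≡ false
open PartialOrientation public

module _ {n} {G : Graph n} (D : PartialOrientation G) where
  Arc : Fin n → Fin n → Set
  Arc x y = arc D x y ≡ true

  Edge : Fin n → Fin n → Set
  Edge x y = (adj G x y ≡ true) × (arc D x y ≡ false) × (arc D y x ≡ false)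

  Joined : Fin n → Fin n → Set
  Joined x z = Edge x z ⊎ Arc x z ⊎ Arc z x

  TwoDipath : Fin n → Fin n → Fin n → Set
  TwoDipath x y z = Arc x y × Arc y z

  QuasiTransitive : Set
  QuasiTransitive =
    (∀ x y z → TwoDipath x y z → x ≢ z → Joined x z)
    × (∀ x y → Edge x y → ∃ λ t → TwoDipath x t y ⊎ TwoDipath y t x)

-- A corner of the triangle of Π and its pendant neighbour have no common neighbour (degree three
-- leaves no room), so quasi-transitivity cannot route the pendant edge through a 2-dipath and it
-- must be an arc; an arc at the corner then forbids, by the induced-2-dipath condition, every arc
-- pointing the other way there, so each corner is a source or a sink. Consequently no triangle
-- edge can be routed through the third corner either, so all three triangle edges are arcs. But
-- two of the three corners are both sources or both sinks, and the arc between them is impossible.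
module Submission where

open import Defs
open import Data.Nat using (ℕ)
open import Relation.Nullary using (¬_)
open import Data.Product using (Σ)

open import Data.Nat using (suc; _≤_; s≤s; z≤n)
open import Data.Nat.Properties using (≤-trans; <-irrefl; <-≤-trans)
open import Data.Nat.ListAction using (sum)
open import Data.Bool using (Bool; true; false; if_then_else_; T)
import Data.Bool.Properties as Bool
open import Data.Fin using (Fin; zero; suc; _≟_)
open import Data.Fin.Patterns using (0F; 1F; 2F; 3F; 4F; 5F)
import Data.Fin.Properties as Fin
open import Data.Fin.Subset using (Subset; ∣_∣; _-_) renaming (_∈_ to _∈ₛ_)
open import Data.Fin.Subset.Properties using (x∈p⇒∣p-x∣<∣p∣; x∈p∧x≢y⇒x∈p-y)
open import Data.List using (List; []; _∷_; length; tabulate)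
open import Data.List.Properties using (map-tabulate)
open import Data.List.Relation.Unary.All using (All; []; _∷_)
import Data.List.Relation.Unary.All as All
open import Data.List.Relation.Unary.All.Properties using (¬Any⇒All¬)
open import Data.List.Relation.Unary.Any using (here; there; any?)
open import Data.List.Relation.Unary.Unique.Propositional using (Unique; []; _∷_)
open import Data.List.Membership.Propositional using (_∈_)
import Data.Vec as Vec
open import Data.Vec.Properties using (lookup∘tabulate; lookup⇒[]=)
open import Data.Product using (_,_; proj₁; proj₂)
open import Data.Sum using (_⊎_; inj₁; inj₂)
open import Data.Empty using (⊥; ⊥-elim)
open import Function using (_∘_; id)
open import Function.Definitions using (Injective)
open import Relation.Nullary using (yes; no)
open import Relation.Nullary.Decidable using (toWitness)
open import Relation.Binary.PropositionalEquality
  using (_≡_; _≢_; refl; sym; trans; cong; subst)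

neighbourhood : ∀ {n} → Graph n → Fin n → Subset n
neighbourhood G x = Vec.tabulate (adj G x)

∈-neighbourhood : ∀ {n} (G : Graph n) {x y} → adj G x y ≡ true → y ∈ₛ neighbourhood G x
∈-neighbourhood G {x} {y} xy = lookup⇒[]= y _ (trans (lookup∘tabulate (adj G x) y) xy)

sum-indicators≡∣tabulate∣ : ∀ n (g : Fin n → Bool) →
  sum (tabulate (λ y → if g y then 1 else 0)) ≡ ∣ Vec.tabulate g ∣
sum-indicators≡∣tabulate∣ 0       g = refl
sum-indicators≡∣tabulate∣ (suc n) g with g zero
... | true  = cong suc (sum-indicators≡∣tabulate∣ n (g ∘ suc))
... | false = sum-indicators≡∣tabulate∣ n (g ∘ suc)

degree≡∣neighbourhood∣ : ∀ {n} (G : Graph n) x → degree G x ≡ ∣ neighbourhood G x ∣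
degree≡∣neighbourhood∣ {n} G x =
  trans (cong sum (map-tabulate id (λ y → if adj G x y then 1 else 0)))
        (sum-indicators≡∣tabulate∣ n (adj G x))

unique-⊆⇒length≤∣p∣ : ∀ {n} {xs : List (Fin n)} {p : Subset n} →
  Unique xs → All (_∈ₛ p) xs → length xs ≤ ∣ p ∣
unique-⊆⇒length≤∣p∣ []                []          = z≤n
unique-⊆⇒length≤∣p∣ {xs = x ∷ xs} {p} (x≢xs ∷ unique-xs) (x∈p ∷ xs⊆p) =
  <-≤-trans (s≤s (unique-⊆⇒length≤∣p∣ unique-xs xs⊆p-x)) (x∈p⇒∣p-x∣<∣p∣ x∈p)
  where
  xs⊆p-x : All (_∈ₛ p - x) xs
  xs⊆p-x = All.zipWith (λ (y∈p , x≢y) → x∈p∧x≢y⇒x∈p-y y∈p (x≢y ∘ sym)) (xs⊆p , x≢xs)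

degree≤length⇒neighbour∈ : ∀ {n} (G : Graph n) {p} {xs : List (Fin n)} →
  degree G p ≤ length xs → Unique xs → All (λ y → adj G p y ≡ true) xs →
  ∀ {t} → adj G p t ≡ true → t ∈ xs
degree≤length⇒neighbour∈ G {p} {xs} deg≤ unique-xs xs⊆N {t} pt with any? (t ≟_) xs
... | yes t∈xs = t∈xs
... | no  t∉xs = ⊥-elim (<-irrefl refl (≤-trans too-many deg≤))
  where
  too-many : length (t ∷ xs) ≤ degree G p
  too-many = subst (length (t ∷ xs) ≤_) (sym (degree≡∣neighbourhood∣ G p))
    (unique-⊆⇒length≤∣p∣ (¬Any⇒All¬ xs t∉xs ∷ unique-xs)
                         (All.map (∈-neighbourhood G) (pt ∷ xs⊆N)))

adjacent-sym : ∀ {n} (G : Graph n) {x y} → adj G x y ≡ true → adj G y x ≡ true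
adjacent-sym G {x} {y} = trans (adj-sym G y x)

module _ {n} {G : Graph n} (D : PartialOrientation G) where

  Source Sink : Fin n → Set
  Source x = ∀ y → ¬ Arc D y x
  Sink   x = ∀ y → ¬ Arc D x y

  Oriented : Fin n → Fin n → Set
  Oriented x y = Arc D x y ⊎ Arc D y x

  arc⇒adjacent : ∀ {x y} → Arc D x y → adj G x y ≡ true
  arc⇒adjacent {x} {y} = arc-edge D x y

  arc-asym : ∀ {x y} → Arc D x y → ¬ Arc D y x
  arc-asym {x} {y} xy yx with trans (sym (arc-unique D x y xy)) yx
  ... | ()

  adjacent⇒edge⊎oriented : ∀ {x y} → adj G x y ≡ true → Edge D x y ⊎ Oriented x y
  adjacent⇒edge⊎oriented {x} {y} xy with arc D x y Bool.≟ true | arc D y x Bool.≟ true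
  ... | yes xy-arc | _          = inj₂ (inj₁ xy-arc)
  ... | no _       | yes yx-arc = inj₂ (inj₂ yx-arc)
  ... | no ¬xy-arc | no ¬yx-arc = inj₁ (xy , Bool.¬-not ¬xy-arc , Bool.¬-not ¬yx-arc)

  joined⇒adjacent : ∀ {x y} → Joined D x y → adj G x y ≡ true
  joined⇒adjacent (inj₁ (xy , _))  = xy
  joined⇒adjacent (inj₂ (inj₁ xy)) = arc⇒adjacent xy
  joined⇒adjacent (inj₂ (inj₂ yx)) = adjacent-sym G (arc⇒adjacent yx)

  middle-not-source⊎sink : ∀ {x y z} → Arc D x y → Arc D y z → ¬ (Source y ⊎ Sink y)
  middle-not-source⊎sink {x}     xy _  (inj₁ source) = source x xy
  middle-not-source⊎sink {z = z} _  yz (inj₂ sink)   = sink z yz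

  sources-not-oriented : ∀ {x y} → Source x → Source y → ¬ Oriented x y
  sources-not-oriented {x} {y} sx sy (inj₁ xy) = sy x xy
  sources-not-oriented {x} {y} sx sy (inj₂ yx) = sx y yx

  sinks-not-oriented : ∀ {x y} → Sink x → Sink y → ¬ Oriented x y
  sinks-not-oriented {x} {y} sx sy (inj₁ xy) = sx y xy
  sinks-not-oriented {x} {y} sx sy (inj₂ yx) = sy x yx

  source⊎sink-triangle-not-oriented : ∀ {u v w} →
    Source u ⊎ Sink u → Source v ⊎ Sink v → Source w ⊎ Sink w →
    Oriented u v → Oriented v w → Oriented w u → ⊥
  source⊎sink-triangle-not-oriented (inj₁ src-u) (inj₁ src-v) _ uv _ _ =
    sources-not-oriented src-u src-v uv
  source⊎sink-triangle-not-oriented (inj₂ snk-u) (inj₂ snk-v) _ uv _ _ =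
    sinks-not-oriented snk-u snk-v uv
  source⊎sink-triangle-not-oriented (inj₁ src-u) (inj₂ _) (inj₁ src-w) _ _ wu =
    sources-not-oriented src-w src-u wu
  source⊎sink-triangle-not-oriented (inj₁ _) (inj₂ snk-v) (inj₂ snk-w) _ vw _ =
    sinks-not-oriented snk-v snk-w vw
  source⊎sink-triangle-not-oriented (inj₂ _) (inj₁ src-v) (inj₁ src-w) _ vw _ =
    sources-not-oriented src-v src-w vw
  source⊎sink-triangle-not-oriented (inj₂ snk-u) (inj₁ _) (inj₂ snk-w) _ _ wu =
    sinks-not-oriented snk-w snk-u wu

  module _ (qt : QuasiTransitive D) where

    dipath⇒adjacent : ∀ {x y z} → TwoDipath D x y z → adj G x z ≡ true
    dipath⇒adjacent {x} {y} {z} (xy , yz) =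
      joined⇒adjacent (proj₁ qt x y z (xy , yz) λ { refl → arc-asym xy yz })

    no-common-neighbour⇒source⊎sink : ∀ {p p′} → adj G p p′ ≡ true →
      (∀ t → adj G p t ≡ true → adj G t p′ ≡ true → ⊥) → Source p ⊎ Sink p
    no-common-neighbour⇒source⊎sink {p} {p′} pp′ no-common with adjacent⇒edge⊎oriented pp′
    ... | inj₁ edge with proj₂ qt p p′ edge
    ...   | t , inj₁ (pt , tp′) = ⊥-elim (no-common t (arc⇒adjacent pt) (arc⇒adjacent tp′))
    ...   | t , inj₂ (p′t , tp) =
      ⊥-elim (no-common t (adjacent-sym G (arc⇒adjacent tp)) (adjacent-sym G (arc⇒adjacent p′t)))
    no-common-neighbour⇒source⊎sink pp′ no-common | inj₂ (inj₁ pp′-arc) =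
      inj₁ λ q qp → no-common q (adjacent-sym G (arc⇒adjacent qp)) (dipath⇒adjacent (qp , pp′-arc))
    no-common-neighbour⇒source⊎sink pp′ no-common | inj₂ (inj₂ p′p-arc) =
      inj₂ λ q pq → no-common q (arc⇒adjacent pq) (adjacent-sym G (dipath⇒adjacent (p′p-arc , pq)))

    common-neighbours-source⊎sink⇒oriented : ∀ {p q} → adj G p q ≡ true →
      (∀ t → adj G p t ≡ true → adj G t q ≡ true → Source t ⊎ Sink t) → Oriented p q
    common-neighbours-source⊎sink⇒oriented {p} {q} pq common with adjacent⇒edge⊎oriented pq
    ... | inj₂ oriented = oriented
    ... | inj₁ edge with proj₂ qt p q edge
    ...   | t , inj₁ (pt , tq) =
      ⊥-elim (middle-not-source⊎sink pt tq (common t (arc⇒adjacent pt) (arc⇒adjacent tq)))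
    ...   | t , inj₂ (qt′ , tp) =
      ⊥-elim (middle-not-source⊎sink qt′ tp
        (common t (adjacent-sym G (arc⇒adjacent tp)) (adjacent-sym G (arc⇒adjacent qt′))))

¬self-adjacent : ∀ {n} (G : Graph n) {x} → ¬ adj G x x ≡ true
¬self-adjacent G {x} xx with trans (sym xx) (irrefl G x)
... | ()

rotate : Fin 6 → Fin 6
rotate 0F = 1F
rotate 1F = 2F
rotate 2F = 0F
rotate 3F = 4F
rotate 4F = 5F
rotate 5F = 3F

rotate³≡id : ∀ a → rotate (rotate (rotate a)) ≡ a
rotate³≡id 0F = refl
rotate³≡id 1F = refl
rotate³≡id 2F = refl
rotate³≡id 3F = refl
rotate³≡id 4F = refl
rotate³≡id 5F = refl

rotate-injective : Injective _≡_ _≡_ rotate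
rotate-injective {a} {b} ra≡rb =
  trans (sym (rotate³≡id a)) (trans (cong (rotate ∘ rotate) ra≡rb) (rotate³≡id b))

Π-adj-rotate : ∀ a b → Π-adj (rotate a) (rotate b) ≡ Π-adj a b
Π-adj-rotate =
  toWitness {a? = Fin.all? λ a → Fin.all? λ b → Π-adj (rotate a) (rotate b) Bool.≟ Π-adj a b} _

rotate-embedding : ∀ {n} (G : Graph n) → PiSubgraphOf G → PiSubgraphOf G
rotate-embedding G (f , f-injective , f-hom) =
  f ∘ rotate , rotate-injective ∘ f-injective ,
  λ a b ab → f-hom (rotate a) (rotate b) (trans (Π-adj-rotate a b) ab)

module Corners {n} {G : Graph n} (max-degree-3 : MaxDegreeAtMost3 G) where

  corner-neighbour∈ : (e : PiSubgraphOf G) → ∀ {t} → adj G (proj₁ e 0F) t ≡ true →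
    t ∈ proj₁ e 1F ∷ proj₁ e 2F ∷ proj₁ e 3F ∷ []
  corner-neighbour∈ (f , f-injective , f-hom) =
    degree≤length⇒neighbour∈ G (max-degree-3 (f 0F)) distinct
      (f-hom 0F 1F refl ∷ f-hom 0F 2F refl ∷ f-hom 0F 3F refl ∷ [])
    where
    ≢⇒f≢ : ∀ a b → a ≢ b → f a ≢ f b
    ≢⇒f≢ a b a≢b = a≢b ∘ f-injective
    distinct : Unique (f 1F ∷ f 2F ∷ f 3F ∷ [])
    distinct = (≢⇒f≢ 1F 2F (λ ()) ∷ ≢⇒f≢ 1F 3F (λ ()) ∷ [])
             ∷ (≢⇒f≢ 2F 3F (λ ()) ∷ [])
             ∷ [] ∷ []

  corner-adjacency-reflected : (e : PiSubgraphOf G) →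
    ∀ a → adj G (proj₁ e 0F) (proj₁ e a) ≡ true → T (Π-adj 0F a)
  corner-adjacency-reflected e@(f , f-injective , _) a ua with corner-neighbour∈ e ua
  ... | here fa≡f1                 = subst (T ∘ Π-adj 0F) (sym (f-injective fa≡f1)) _
  ... | there (here fa≡f2)         = subst (T ∘ Π-adj 0F) (sym (f-injective fa≡f2)) _
  ... | there (there (here fa≡f3)) = subst (T ∘ Π-adj 0F) (sym (f-injective fa≡f3)) _

  pendant-not-adjacent-to-next-corner : (e : PiSubgraphOf G) →
    ¬ adj G (proj₁ e 1F) (proj₁ e 3F) ≡ true
  pendant-not-adjacent-to-next-corner e = corner-adjacency-reflected (rotate-embedding G e) 5F

  pendant-not-adjacent-to-previous-corner : (e : PiSubgraphOf G) →
    ¬ adj G (proj₁ e 2F) (proj₁ e 3F) ≡ true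
  pendant-not-adjacent-to-previous-corner e =
    corner-adjacency-reflected (rotate-embedding G (rotate-embedding G e)) 4F

  module Orientation (D : PartialOrientation G) (qt : QuasiTransitive D) where

    corner-source⊎sink : (e : PiSubgraphOf G) → Source D (proj₁ e 0F) ⊎ Sink D (proj₁ e 0F)
    corner-source⊎sink e@(f , _ , f-hom) =
      no-common-neighbour⇒source⊎sink D qt (f-hom 0F 3F refl) private-pendant
      where
      private-pendant : ∀ t → adj G (f 0F) t ≡ true → adj G t (f 3F) ≡ true → ⊥
      private-pendant t ut tu′ with corner-neighbour∈ e ut
      ... | here refl                 = pendant-not-adjacent-to-next-corner e tu′
      ... | there (here refl)         = pendant-not-adjacent-to-previous-corner e tu′
      ... | there (there (here refl)) = ¬self-adjacent G tu′

    corner-edge-oriented : (e : PiSubgraphOf G) → Oriented D (proj₁ e 0F) (proj₁ e 1F)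
    corner-edge-oriented e@(f , _ , f-hom) =
      common-neighbours-source⊎sink⇒oriented D qt (f-hom 0F 1F refl) common
      where
      common : ∀ t → adj G (f 0F) t ≡ true → adj G t (f 1F) ≡ true → Source D t ⊎ Sink D t
      common t ut tv with corner-neighbour∈ e ut
      ... | here refl                 = ⊥-elim (¬self-adjacent G tv)
      ... | there (here refl)         = corner-source⊎sink (rotate-embedding G (rotate-embedding G e))
      ... | there (there (here refl)) =
        ⊥-elim (pendant-not-adjacent-to-next-corner e (adjacent-sym G tv))

lemma3p4 : ∀ (n : ℕ) (Γ : Graph n) → MaxDegreeAtMost3 Γ → PiSubgraphOf Γ →
    ¬ (Σ (PartialOrientation Γ) QuasiTransitive)
lemma3p4 n Γ max-degree-3 e (D , qt) =
  source⊎sink-triangle-not-oriented D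
    (corner-source⊎sink e) (corner-source⊎sink e₁) (corner-source⊎sink e₂)
    (corner-edge-oriented e) (corner-edge-oriented e₁) (corner-edge-oriented e₂)
  where
  open Corners.Orientation max-degree-3 D qt
  e₁ e₂ : PiSubgraphOf Γ
  e₁ = rotate-embedding Γ e
  e₂ = rotate-embedding Γ e₁
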